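{- Let $\mathbb{T}$ be a type theory and $\mathcal{C}$ a model of $\mathbb{T}$. The contextual core $\operatorname{cxl}\mathcal{C}$, together with its canonical morphism $\operatorname{cxl}\mathcal{C}\to\mathcal{C}$, is initial among models of $\mathbb{T}$ equipped with a contextual isomorphism into $\mathcal{C}$: for every model $\mathcal{D}$ and contextual isomorphism $F:\mathcal{D}\to\mathcal{C}$ there is a unique morphism $\operatorname{cxl}\mathcal{C}\to\mathcal{D}$ whose composite with $F$ is the canonical morphism.
   Context: A category with families (CwF) is a category with a chosen terminal object, a presheaf of types and a locally representable dependent presheaf of terms (giving context extensions). A type theory $\mathbb{T}$ extends the structure of CwFs by operations and equations on types and terms (no new sorts); $\mathbf{Mod}_{\mathbb{T}}$ is its category of models, whose morphisms strictly preserve terminal object, context extensions and all operations; it has an initial model $\mathbf{0}_{\mathbb{T}}$. A morphism is a contextual isomorphism if its actions on types and terms are bijective. Contextual extensions are the morphisms left orthogonal to all contextual isomorphisms; these two classes form an orthogonal factorization system, and models of $\mathbb{T}$ can be transported along it. The contextual core $\operatorname{cxl}\mathcal{C}$ is the middle object of the factorization $\mathbf{0}_{\mathbb{T}}\to\operatorname{cxl}\mathcal{C}\to\mathcal{C}$ of the unique morphism into a contextual extension followed by a contextual isomorphism. -}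

module Defs where

open import Level using (Level; 0ℓ) renaming (suc to lsuc)
open import Data.Product using (Σ; Σ-syntax; _×_; _,_)
open import Function.Definitions using (Bijective)
open import Relation.Binary.PropositionalEquality as P using (_≡_; refl)
open import Relation.Binary.HeterogeneousEquality as H using (_≅_; refl)

-- Equations between terms whose types are only propositionally
-- equal are stated with heterogeneous equality.

record CwF : Set₁ where
  infixl 9 _∘_
  infixl 5 _▹_
  infixl 4 _,ₛ_
  infixl 8 _[_]T _[_]t
  field
    Con  : Set
    Sub  : Con → Con → Set
    id   : ∀ {Γ} → Sub Γ Γ
    _∘_  : ∀ {Γ Δ Θ} → Sub Δ Θ → Sub Γ Δ → Sub Γ Θ
    idl  : ∀ {Γ Δ} (σ : Sub Γ Δ) → id ∘ σ ≡ σ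
    idr  : ∀ {Γ Δ} (σ : Sub Γ Δ) → σ ∘ id ≡ σ
    ass  : ∀ {Γ Δ Θ Ξ} (σ : Sub Θ Ξ) (τ : Sub Δ Θ) (ν : Sub Γ Δ) →
           (σ ∘ τ) ∘ ν ≡ σ ∘ (τ ∘ ν)
    ◇    : Con
    ε    : ∀ {Γ} → Sub Γ ◇
    ◇η   : ∀ {Γ} (σ : Sub Γ ◇) → σ ≡ ε
    Ty    : Con → Set
    _[_]T : ∀ {Γ Δ} → Ty Δ → Sub Γ Δ → Ty Γ
    [id]T : ∀ {Γ} (A : Ty Γ) → A [ id ]T ≡ A
    [∘]T  : ∀ {Γ Δ Θ} (A : Ty Θ) (σ : Sub Δ Θ) (τ : Sub Γ Δ) →
            A [ σ ∘ τ ]T ≡ A [ σ ]T [ τ ]T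
    Tm    : (Γ : Con) → Ty Γ → Set
    _[_]t : ∀ {Γ Δ} {A : Ty Δ} → Tm Δ A → (σ : Sub Γ Δ) → Tm Γ (A [ σ ]T)
    [id]t : ∀ {Γ} {A : Ty Γ} (t : Tm Γ A) → t [ id ]t ≅ t
    [∘]t  : ∀ {Γ Δ Θ} {A : Ty Θ} (t : Tm Θ A) (σ : Sub Δ Θ) (τ : Sub Γ Δ) →
            t [ σ ∘ τ ]t ≅ t [ σ ]t [ τ ]t
    _▹_  : (Γ : Con) → Ty Γ → Con
    p    : ∀ {Γ} {A : Ty Γ} → Sub (Γ ▹ A) Γ
    q    : ∀ {Γ} {A : Ty Γ} → Tm (Γ ▹ A) (A [ p ]T)
    _,ₛ_ : ∀ {Γ Δ} {A : Ty Δ} (σ : Sub Γ Δ) → Tm Γ (A [ σ ]T) → Sub Γ (Δ ▹ A)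
    ▹β₁  : ∀ {Γ Δ} {A : Ty Δ} (σ : Sub Γ Δ) (t : Tm Γ (A [ σ ]T)) →
           p ∘ (σ ,ₛ t) ≡ σ
    ▹β₂  : ∀ {Γ Δ} {A : Ty Δ} (σ : Sub Γ Δ) (t : Tm Γ (A [ σ ]T)) →
           q [ σ ,ₛ t ]t ≅ t
    ▹η   : ∀ {Γ Δ} {A : Ty Δ} (σ : Sub Γ (Δ ▹ A)) →
           (p ∘ σ ,ₛ P.subst (Tm Γ) (P.sym ([∘]T A p σ)) (q [ σ ]t)) ≡ σ

open CwF

record CwFHom (C D : CwF) : Set where
  private
    module C = CwF C
    module D = CwF D
  field
    Con  : C.Con → D.Con
    Sub  : ∀ {Γ Δ} → C.Sub Γ Δ → D.Sub (Con Γ) (Con Δ)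
    Ty   : ∀ {Γ} → C.Ty Γ → D.Ty (Con Γ)
    Tm   : ∀ {Γ} {A : C.Ty Γ} → C.Tm Γ A → D.Tm (Con Γ) (Ty A)
    id-pres  : ∀ {Γ} → Sub (C.id {Γ}) ≡ D.id
    ∘-pres   : ∀ {Γ Δ Θ} (σ : C.Sub Δ Θ) (τ : C.Sub Γ Δ) →
               Sub (σ C.∘ τ) ≡ Sub σ D.∘ Sub τ
    ◇-pres   : Con C.◇ ≡ D.◇
    []T-pres : ∀ {Γ Δ} (A : C.Ty Δ) (σ : C.Sub Γ Δ) →
               Ty (A C.[ σ ]T) ≡ Ty A D.[ Sub σ ]T
    []t-pres : ∀ {Γ Δ} {A : C.Ty Δ} (t : C.Tm Δ A) (σ : C.Sub Γ Δ) →
               Tm (t C.[ σ ]t) ≅ Tm t D.[ Sub σ ]t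
    ▹-pres   : ∀ {Γ} (A : C.Ty Γ) → Con (Γ C.▹ A) ≡ Con Γ D.▹ Ty A
    p-pres   : ∀ {Γ} (A : C.Ty Γ) → Sub (C.p {Γ} {A}) ≅ D.p {Con Γ} {Ty A}
    q-pres   : ∀ {Γ} (A : C.Ty Γ) → Tm (C.q {Γ} {A}) ≅ D.q {Con Γ} {Ty A}

idHom : (C : CwF) → CwFHom C C
idHom C = record
  { Con = λ Γ → Γ ; Sub = λ σ → σ ; Ty = λ A → A ; Tm = λ t → t
  ; id-pres = refl ; ∘-pres = λ _ _ → refl ; ◇-pres = refl
  ; []T-pres = λ _ _ → refl ; []t-pres = λ _ _ → refl
  ; ▹-pres = λ _ → refl ; p-pres = λ _ → refl ; q-pres = λ _ → refl }

module _ {C D E : CwF} (G : CwFHom D E) (F : CwFHom C D) where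
  private
    module C = CwF C
    module D = CwF D
    module E = CwF E
    module G = CwFHom G
    module F = CwFHom F

  private
    Sub-cong : ∀ {Γ Γ' Δ} {σ : D.Sub Γ Δ} {σ' : D.Sub Γ' Δ} →
               Γ ≡ Γ' → σ ≅ σ' → G.Sub σ ≅ G.Sub σ'
    Sub-cong refl refl = refl

    sub-cong : ∀ {Γ Γ' Δ} (A : D.Ty Δ) {σ : D.Sub Γ Δ} {σ' : D.Sub Γ' Δ} →
               Γ ≡ Γ' → σ ≅ σ' → A D.[ σ ]T ≅ A D.[ σ' ]T
    sub-cong A refl refl = refl

    Tm-cong : ∀ {Γ Γ'} {A : D.Ty Γ} {A' : D.Ty Γ'}
                {x : D.Tm Γ A} {y : D.Tm Γ' A'} →
              Γ ≡ Γ' → A ≅ A' → x ≅ y → G.Tm x ≅ G.Tm y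
    Tm-cong refl refl refl = refl

  _∘Hom_ : CwFHom C E
  _∘Hom_ = record
    { Con = λ Γ → G.Con (F.Con Γ)
    ; Sub = λ σ → G.Sub (F.Sub σ)
    ; Ty  = λ A → G.Ty (F.Ty A)
    ; Tm  = λ t → G.Tm (F.Tm t)
    ; id-pres  = P.trans (P.cong G.Sub F.id-pres) G.id-pres
    ; ∘-pres   = λ σ τ → P.trans (P.cong G.Sub (F.∘-pres σ τ))
                                 (G.∘-pres (F.Sub σ) (F.Sub τ))
    ; ◇-pres   = P.trans (P.cong G.Con F.◇-pres) G.◇-pres
    ; []T-pres = λ A σ → P.trans (P.cong G.Ty (F.[]T-pres A σ))
                                 (G.[]T-pres (F.Ty A) (F.Sub σ))
    ; []t-pres = λ t σ → H.trans (Tm-cong refl (H.≡-to-≅ (F.[]T-pres _ σ))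
                                              (F.[]t-pres t σ))
                                 (G.[]t-pres (F.Tm t) (F.Sub σ))
    ; ▹-pres   = λ A → P.trans (P.cong G.Con (F.▹-pres A))
                               (G.▹-pres (F.Ty A))
    ; p-pres   = λ A → H.trans (Sub-cong (F.▹-pres A) (F.p-pres A))
                               (G.p-pres (F.Ty A))
    ; q-pres   = λ {Γ} A → H.trans
        (Tm-cong (F.▹-pres A)
                 (H.trans (H.≡-to-≅ (F.[]T-pres A (C.p {Γ} {A})))
                          (sub-cong (F.Ty A) (F.▹-pres A) (F.p-pres A)))
                 (F.q-pres A))
        (G.q-pres (F.Ty A))
    }

record _≈Hom_ {C D : CwF} (F G : CwFHom C D) : Set where
  private
    module C = CwF C
    module F = CwFHom F
    module G = CwFHom G
  field
    Con≈ : ∀ Γ → F.Con Γ ≡ G.Con Γ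
    Sub≈ : ∀ {Γ Δ} (σ : C.Sub Γ Δ) → F.Sub σ ≅ G.Sub σ
    Ty≈  : ∀ {Γ} (A : C.Ty Γ) → F.Ty A ≅ G.Ty A
    Tm≈  : ∀ {Γ} {A : C.Ty Γ} (t : C.Tm Γ A) → F.Tm t ≅ G.Tm t

-- A type theory T: extra structure (operations and equations on types
-- and terms) on a CwF, together with the condition that a CwF morphism
-- strictly preserves that structure; preservation is closed under
-- identities and composition.

record TypeTheory : Set₂ where
  field
    Str     : CwF → Set₁
    Pres    : ∀ {C D} → Str C → Str D → CwFHom C D → Set
    pres-id : ∀ {C} (S : Str C) → Pres S S (idHom C)
    pres-∘  : ∀ {C D E} {S : Str C} {S' : Str D} {S'' : Str E}
                {G : CwFHom D E} {F : CwFHom C D} →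
              Pres S' S'' G → Pres S S' F → Pres S S'' (G ∘Hom F)

module _ (T : TypeTheory) where
  open TypeTheory T

  record Model : Set₁ where
    field
      cwf : CwF
      str : Str cwf

  open Model

  record Hom (M N : Model) : Set where
    field
      hom  : CwFHom (cwf M) (cwf N)
      pres : Pres (str M) (str N) hom

  open Hom

  idM : (M : Model) → Hom M M
  idM M = record { hom = idHom (cwf M) ; pres = pres-id (str M) }

  _∘M_ : ∀ {L M N} → Hom M N → Hom L M → Hom L N
  G ∘M F = record { hom = hom G ∘Hom hom F ; pres = pres-∘ (pres G) (pres F) }

  _≈M_ : ∀ {M N} → Hom M N → Hom M N → Set
  F ≈M G = hom F ≈Hom hom G

  IsInitial : Model → Set₁
  IsInitial I = ∀ (X : Model) → Σ[ f ∈ Hom I X ] (∀ (g : Hom I X) → g ≈M f)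

  IsContextualIso : ∀ {M N} → Hom M N → Set
  IsContextualIso {M} {N} F =
    (∀ (Γ : Con (cwf M)) →
        Bijective _≡_ _≡_ (CwFHom.Ty (hom F) {Γ})) ×
    (∀ (Γ : Con (cwf M)) (A : Ty (cwf M) Γ) →
        Bijective _≡_ _≡_ (CwFHom.Tm (hom F) {Γ} {A}))

  _⊥_ : ∀ {A B X Y} → Hom A B → Hom X Y → Set
  _⊥_ {A} {B} {X} {Y} e m =
    ∀ (u : Hom A X) (v : Hom B Y) → (m ∘M u) ≈M (v ∘M e) →
    Σ[ d ∈ Hom B X ] ((d ∘M e) ≈M u × (m ∘M d) ≈M v ×
      (∀ (d' : Hom B X) → (d' ∘M e) ≈M u → (m ∘M d') ≈M v → d' ≈M d))

  IsContextualExtension : ∀ {A B} → Hom A B → Set₁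
  IsContextualExtension e =
    ∀ {X Y : Model} (m : Hom X Y) → IsContextualIso m → e ⊥ m

-- The square formed by e, the unique morphism I → D, F and m commutes
-- automatically because I is initial, so the unique diagonal filler given by
-- orthogonality of the contextual extension e against the contextual
-- isomorphism F is the required unique factorisation of m through F.
module Submission where

open import Defs
open import Data.Product using (Σ; Σ-syntax; _×_; _,_; proj₁; proj₂)
open import Relation.Binary.PropositionalEquality as P using ()
open import Relation.Binary.HeterogeneousEquality as H using ()

≈Hom-sym : ∀ {C D} {F G : CwFHom C D} → F ≈Hom G → G ≈Hom F
≈Hom-sym F≈G = record
  { Con≈ = λ Γ → P.sym (Con≈ Γ)
  ; Sub≈ = λ σ → H.sym (Sub≈ σ)
  ; Ty≈  = λ A → H.sym (Ty≈ A)
  ; Tm≈  = λ t → H.sym (Tm≈ t)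
  }
  where open _≈Hom_ F≈G

≈Hom-trans : ∀ {C D} {F G K : CwFHom C D} → F ≈Hom G → G ≈Hom K → F ≈Hom K
≈Hom-trans F≈G G≈K = record
  { Con≈ = λ Γ → P.trans (F≈G.Con≈ Γ) (G≈K.Con≈ Γ)
  ; Sub≈ = λ σ → H.trans (F≈G.Sub≈ σ) (G≈K.Sub≈ σ)
  ; Ty≈  = λ A → H.trans (F≈G.Ty≈ A) (G≈K.Ty≈ A)
  ; Tm≈  = λ t → H.trans (F≈G.Tm≈ t) (G≈K.Tm≈ t)
  }
  where
  module F≈G = _≈Hom_ F≈G
  module G≈K = _≈Hom_ G≈K

module _ (T : TypeTheory) where

  initial-hom-unique : ∀ {I X} → IsInitial T I →
                       (f g : Hom T I X) → _≈M_ T f g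
  initial-hom-unique {X = X} I-initial f g =
    ≈Hom-trans (proj₂ (I-initial X) f) (≈Hom-sym (proj₂ (I-initial X) g))

  orthogonal-from-initial⇒unique-factorisation :
    ∀ {I X C D} → IsInitial T I →
    (e : Hom T I X) (F : Hom T D C) → _⊥_ T e F → (m : Hom T X C) →
    Σ[ g ∈ Hom T X D ] (_≈M_ T (_∘M_ T F g) m ×
      (∀ (g' : Hom T X D) → _≈M_ T (_∘M_ T F g') m → _≈M_ T g' g))
  orthogonal-from-initial⇒unique-factorisation {I} {D = D} I-initial e F e⊥F m
    with u ← proj₁ (I-initial D)
    with e⊥F u m (initial-hom-unique I-initial (_∘M_ T F u) (_∘M_ T m e))
  ... | g , _ , F∘g≈m , unique =
    g , F∘g≈m , λ g' F∘g'≈m →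
      unique g' (initial-hom-unique I-initial (_∘M_ T g' e) u) F∘g'≈m

proposition2p7 : (T : TypeTheory) (I : Model T) → IsInitial T I →
    (C X : Model T) (e : Hom T I X) (m : Hom T X C) →
    IsContextualExtension T e → IsContextualIso T m →
    (D : Model T) (F : Hom T D C) → IsContextualIso T F →
    Σ[ g ∈ Hom T X D ] (_≈M_ T (_∘M_ T F g) m ×
      (∀ (g' : Hom T X D) → _≈M_ T (_∘M_ T F g') m → _≈M_ T g' g))
proposition2p7 T I I-initial C X e m e-extension _ D F F-iso =
  orthogonal-from-initial⇒unique-factorisation T I-initial e F
    (e-extension F F-iso) m
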